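{- Let $1\le k<n$ and let $b=b_{k+1}\ldots b_n$ be an admissible suffix in $A_n$. Then $\alpha_A(b)=\{k-1\}$ if $\mu_A(b)=k$, or if $\mu_A(b)=k-1$ and $b_{k+1}=0$; $\alpha_A(b)=\{0,1,\ldots,b_{k+1}-1\}\cup\{k-1\}$ if $\mu_A(b)=k-1$ and $0<b_{k+1}<k$; $\alpha_A(b)=\{0,1,\ldots,k-1\}$ if $\mu_A(b)<k-1$. Moreover, for the empty suffix, $\alpha_A(\epsilon)=\{0,1,\ldots,n-1\}$.
   Context: For a sequence $s_1\ldots s_m$, $\mathrm{asc}(s_1\ldots s_m)=\#\{i<m: s_i<s_{i+1}\}$. $A_n$ is the set of sequences $s_1\ldots s_n$ of non-negative integers with $s_1=0$ and $0\le s_{k+1}\le\mathrm{asc}(s_1\ldots s_k)+1$ for $1\le k<n$. A word $b=b_{k+1}\ldots b_n$ is an admissible suffix in $A_n$ if some sequence of $A_n$ ends with $b$. For such $b$ (with $1\le k<n$): $\alpha_A(b)=\{x : xb \text{ is an admissible suffix in } A_n\}$, and $\mu_A(b)=\min\{\mathrm{asc}(s_1\ldots s_kb_{k+1}) : s_1\ldots s_kb\in A_n\}$. For the empty suffix $\epsilon$, $\alpha_A(\epsilon)$ is defined as $\{0,\ldots,n-1\}$. -}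

module Defs where

open import Data.Nat using (ℕ; zero; suc; _+_; _≤_; _<ᵇ_)
open import Data.Bool using (if_then_else_)
open import Data.List using (List; []; _∷_; _++_; length)
open import Data.Product using (Σ; ∃; _×_; _,_)
open import Relation.Binary.PropositionalEquality using (_≡_; _≢_)

asc : List ℕ → ℕ
asc (x ∷ y ∷ r) = (if x <ᵇ y then 1 else 0) + asc (y ∷ r)
asc _ = 0

record InA (n : ℕ) (s : List ℕ) : Set where
  field
    len   : length s ≡ n
    first : ∃ λ post → s ≡ 0 ∷ post
    bound : ∀ (pre : List ℕ) (x : ℕ) (post : List ℕ) →
            s ≡ pre ++ (x ∷ post) → pre ≢ [] → x ≤ asc pre + 1

Admissible : ℕ → List ℕ → Set
Admissible n b = ∃ λ pre → InA n (pre ++ b)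

-- α_A(b) as a predicate on ℕ:  x ∈ α_A(b)  iff  x b is an admissible suffix.
α : ℕ → List ℕ → ℕ → Set
α n b x = Admissible n (x ∷ b)

-- IsMu n k b₁ bs m : m = μ_A(b) for b = b₁ bs = b_{k+1} … b_n, i.e. m is the
-- minimum of asc(s₁…s_k b_{k+1}) over all s₁…s_k b ∈ A_n (attained and a lower bound).
IsMu : ℕ → ℕ → ℕ → List ℕ → ℕ → Set
IsMu n k b₁ bs m =
  (∃ λ pre → length pre ≡ k × InA n (pre ++ b₁ ∷ bs) × asc (pre ++ b₁ ∷ []) ≡ m)
  × (∀ pre → length pre ≡ k → InA n (pre ++ b₁ ∷ bs) → m ≤ asc (pre ++ b₁ ∷ []))

-- Write a(s) for the number of ascents of s. A suffix b = b_{k+1} … b_n that follows some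
-- admissible prefix s′ of length k also follows every admissible prefix s of length k with
-- b_{k+1} ≤ a(s) + 1 and a(s′ b_{k+1}) ≤ a(s b_{k+1}). Among admissible prefixes ending in x
-- the staircase 0 1 … (k-2) x has the most ascents, even after appending any letter, so
-- x ∈ α_A(b) iff the staircase ending in x satisfies both conditions against a prefix
-- attaining μ_A(b). That staircase has k-1 ascents if x = k-1 and k-2 if x < k-1, and
-- comparing these numbers with μ_A(b) gives the three cases.
module Submission where

open import Defs
open import Data.Nat using (ℕ; zero; suc; _+_; _∸_; _≤_; _<_; z≤n; s≤s; _<ᵇ_; _≤?_; _<?_)
open import Data.Nat.Properties
open import Data.Bool using (true; false; if_then_else_; T)
open import Data.Unit using (tt)
open import Data.List using (List; []; _∷_; _++_; _∷ʳ_; length)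
open import Data.List.Properties
  using (++-assoc; ++-identityʳ; length-++; ∷-injectiveˡ; ∷-injectiveʳ; ∷ʳ-++)
open import Data.List.Reverse using (Reverse; []; _∶_∶ʳ_; reverseView)
open import Data.Product using (_×_; _,_; ∃; proj₁; proj₂)
open import Data.Sum using (_⊎_; inj₁; inj₂)
open import Data.Empty using (⊥; ⊥-elim)
open import Function.Bundles using (_⇔_; mk⇔; Equivalence)
open import Relation.Binary.PropositionalEquality
open import Relation.Nullary using (yes; no)

ascent : ℕ → ℕ → ℕ
ascent x y = if x <ᵇ y then 1 else 0

ascent-< : ∀ {x y} → x < y → ascent x y ≡ 1
ascent-< {x} {y} x<y with x <ᵇ y | <⇒<ᵇ x<y
... | true | _ = refl

ascent-≥ : ∀ {x y} → y ≤ x → ascent x y ≡ 0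
ascent-≥ {x} {y} y≤x with x <ᵇ y in eq
... | false = refl
... | true  = ⊥-elim (<⇒≱ (<ᵇ⇒< x y (subst T (sym eq) tt)) y≤x)

ascent≤1 : ∀ x y → ascent x y ≤ 1
ascent≤1 x y with x <ᵇ y
... | true  = ≤-refl
... | false = z≤n

ascent-antimonoˡ-≤ : ∀ {x x′ y} → x ≤ x′ → ascent x′ y ≤ ascent x y
ascent-antimonoˡ-≤ {x} {x′} {y} x≤x′ with x′ <? y
... | yes x′<y = ≤-reflexive (trans (ascent-< x′<y) (sym (ascent-< (≤-<-trans x≤x′ x′<y))))
... | no  x′≮y = ≤-trans (≤-reflexive (ascent-≥ (≮⇒≥ x′≮y))) z≤n

asc-++-∷ : ∀ p y r → asc (p ++ y ∷ r) ≡ asc (p ∷ʳ y) + asc (y ∷ r)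
asc-++-∷ []           y r = refl
asc-++-∷ (a ∷ [])     y r = cong (_+ asc (y ∷ r)) (sym (+-identityʳ (ascent a y)))
asc-++-∷ (a ∷ a′ ∷ p) y r =
  trans (cong (ascent a a′ +_) (asc-++-∷ (a′ ∷ p) y r))
        (sym (+-assoc (ascent a a′) (asc (a′ ∷ p ∷ʳ y)) (asc (y ∷ r))))

asc-∷ʳ-∷ʳ : ∀ p l x → asc (p ∷ʳ l ∷ʳ x) ≡ asc (p ∷ʳ l) + ascent l x
asc-∷ʳ-∷ʳ p l x = begin
  asc (p ∷ʳ l ∷ʳ x)                  ≡⟨ cong asc (∷ʳ-++ p l (x ∷ [])) ⟩
  asc (p ++ l ∷ x ∷ [])              ≡⟨ asc-++-∷ p l (x ∷ []) ⟩
  asc (p ∷ʳ l) + (ascent l x + 0)    ≡⟨ cong (asc (p ∷ʳ l) +_) (+-identityʳ (ascent l x)) ⟩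
  asc (p ∷ʳ l) + ascent l x          ∎
  where open ≡-Reasoning

length-∷ʳ : ∀ {A : Set} (p : List A) x → length (p ∷ʳ x) ≡ suc (length p)
length-∷ʳ p x = trans (length-++ p) (+-comm (length p) 1)

++-∷≢[] : ∀ {A : Set} (p : List A) {y r} → p ++ y ∷ r ≢ []
++-∷≢[] []      ()
++-∷≢[] (_ ∷ _) ()

split-++≡++-∷ : ∀ {A : Set} (p : List A) {r P y post} → p ++ r ≡ P ++ y ∷ post →
  (∃ λ w → p ≡ P ++ y ∷ w) ⊎ (∃ λ u → P ≡ p ++ u × r ≡ u ++ y ∷ post)
split-++≡++-∷ []      {P = P} eq  = inj₂ (P , refl , eq)
split-++≡++-∷ (a ∷ p) {P = []} refl = inj₁ (p , refl)
split-++≡++-∷ (a ∷ p) {P = b ∷ P} eq with split-++≡++-∷ p (∷-injectiveʳ eq)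
... | inj₁ (w , p≡)      = inj₁ (w , cong₂ _∷_ (∷-injectiveˡ eq) p≡)
... | inj₂ (u , P≡ , r≡) = inj₂ (u , cong₂ _∷_ (sym (∷-injectiveˡ eq)) P≡ , r≡)

InA-head : ∀ {n x s} → InA n (x ∷ s) → x ≡ 0
InA-head ia = ∷-injectiveˡ (proj₂ (InA.first ia))

InA-[0] : InA 1 (0 ∷ [])
InA-[0] = record { len = refl ; first = [] , refl ; bound = bound }
  where
  bound : ∀ P y post → 0 ∷ [] ≡ P ++ y ∷ post → P ≢ [] → y ≤ asc P + 1
  bound []          _ _ _  P≢[] = ⊥-elim (P≢[] refl)
  bound (_ ∷ [])    _ _ ()
  bound (_ ∷ _ ∷ _) _ _ ()

InA-prefix : ∀ {n} p q → p ≢ [] → InA n (p ++ q) → InA (length p) p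
InA-prefix []      q p≢[] _  = ⊥-elim (p≢[] refl)
InA-prefix (x ∷ p) q _    ia = record
  { len   = refl
  ; first = p , cong (_∷ p) (InA-head ia)
  ; bound = λ P y w eq → InA.bound ia P y (w ++ q) (trans (cong (_++ q) eq) (++-assoc P (y ∷ w) q))
  }

InA-++ : ∀ {L q} r → InA L q →
  (∀ u y v → r ≡ u ++ y ∷ v → y ≤ asc (q ++ u) + 1) → InA (L + length r) (q ++ r)
InA-++ {L} {q} r iq r-bounded = record
  { len   = trans (length-++ q) (cong (_+ length r) (InA.len iq))
  ; first = proj₁ (InA.first iq) ++ r , cong (_++ r) (proj₂ (InA.first iq))
  ; bound = bound
  }
  where
  bound : ∀ P y post → q ++ r ≡ P ++ y ∷ post → P ≢ [] → y ≤ asc P + 1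
  bound P y post eq P≢[] with split-++≡++-∷ q eq
  ... | inj₁ (w , q≡)      = InA.bound iq P y w q≡ P≢[]
  ... | inj₂ (u , P≡ , r≡) = subst (λ P → y ≤ asc P + 1) (sym P≡) (r-bounded u y post r≡)

InA-∷ʳ : ∀ {L q x} → InA L q → x ≤ asc q + 1 → InA (suc L) (q ∷ʳ x)
InA-∷ʳ {L} {q} {x} iq x≤ =
  subst (λ n → InA n (q ∷ʳ x)) (+-comm L 1) (InA-++ (x ∷ []) iq bounded)
  where
  bounded : ∀ u y v → x ∷ [] ≡ u ++ y ∷ v → y ≤ asc (q ++ u) + 1
  bounded []          _ _ refl = subst (λ q′ → x ≤ asc q′ + 1) (sym (++-identityʳ q)) x≤
  bounded (_ ∷ [])    _ _ ()
  bounded (_ ∷ _ ∷ _) _ _ ()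

InA-replace-prefix : ∀ {n p q y r} → InA n (p ++ y ∷ r) → InA (length p) q →
  y ≤ asc q + 1 → asc (p ∷ʳ y) ≤ asc (q ∷ʳ y) → InA n (q ++ y ∷ r)
InA-replace-prefix {n} {p} {q} {y} {r} ip iq y≤ p≤q =
  subst (λ n → InA n (q ++ y ∷ r)) (trans (sym (length-++ p)) (InA.len ip))
        (InA-++ (y ∷ r) iq bounded)
  where
  later : ∀ u z v → r ≡ u ++ z ∷ v → z ≤ asc (q ++ y ∷ u) + 1
  later u z v r≡ = ≤-trans (InA.bound ip (p ++ y ∷ u) z v eq (++-∷≢[] p)) (+-monoˡ-≤ 1 p≤q-extended)
    where
    open ≤-Reasoning
    p≤q-extended : asc (p ++ y ∷ u) ≤ asc (q ++ y ∷ u)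
    p≤q-extended = begin
      asc (p ++ y ∷ u)             ≡⟨ asc-++-∷ p y u ⟩
      asc (p ∷ʳ y) + asc (y ∷ u)   ≤⟨ +-monoˡ-≤ (asc (y ∷ u)) p≤q ⟩
      asc (q ∷ʳ y) + asc (y ∷ u)   ≡⟨ asc-++-∷ q y u ⟨
      asc (q ++ y ∷ u)             ∎
    eq : p ++ y ∷ r ≡ (p ++ y ∷ u) ++ z ∷ v
    eq = trans (cong (λ r → p ++ y ∷ r) r≡) (sym (++-assoc p (y ∷ u) (z ∷ v)))
  bounded : ∀ u z v → y ∷ r ≡ u ++ z ∷ v → z ≤ asc (q ++ u) + 1
  bounded []      _ _ refl = subst (λ q′ → y ≤ asc q′ + 1) (sym (++-identityʳ q)) y≤
  bounded (w ∷ u) z v eq   =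
    subst (λ w → z ≤ asc (q ++ w ∷ u) + 1) (∷-injectiveˡ eq) (later u z v (∷-injectiveʳ eq))

stair : ℕ → List ℕ
stair zero    = []
stair (suc L) = stair L ∷ʳ L

asc-stair-∷ʳ-≥ : ∀ L {x} → L ≤ x → asc (stair L ∷ʳ x) ≡ L
asc-stair-∷ʳ-≥ zero    _   = refl
asc-stair-∷ʳ-≥ (suc L) {x} L<x = begin
  asc (stair L ∷ʳ L ∷ʳ x)             ≡⟨ asc-∷ʳ-∷ʳ (stair L) L x ⟩
  asc (stair L ∷ʳ L) + ascent L x     ≡⟨ cong₂ _+_ (asc-stair-∷ʳ-≥ L ≤-refl) (ascent-< L<x) ⟩
  L + 1                               ≡⟨ +-comm L 1 ⟩
  suc L                               ∎
  where open ≡-Reasoning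

asc-stair-suc-∷ʳ : ∀ L x → asc (stair (suc L) ∷ʳ x) ≡ L + ascent L x
asc-stair-suc-∷ʳ L x =
  trans (asc-∷ʳ-∷ʳ (stair L) L x) (cong (_+ ascent L x) (asc-stair-∷ʳ-≥ L ≤-refl))

asc-stair-∷ʳ-< : ∀ {L x} → x < L → suc (asc (stair L ∷ʳ x)) ≡ L
asc-stair-∷ʳ-< {suc L} {x} (s≤s x≤L) =
  cong suc (trans (asc-stair-suc-∷ʳ L x) (trans (cong (L +_) (ascent-≥ x≤L)) (+-identityʳ L)))

asc-stair-∷ʳ≤ : ∀ L x → asc (stair L ∷ʳ x) ≤ L
asc-stair-∷ʳ≤ L x with L ≤? x
... | yes L≤x = ≤-reflexive (asc-stair-∷ʳ-≥ L L≤x)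
... | no  L≰x = ≤-trans (n≤1+n _) (≤-reflexive (asc-stair-∷ʳ-< (≰⇒> L≰x)))

stair-∷ʳ-maximal : ∀ L l x → asc (stair L ∷ʳ l) + ascent l x ≤ L + ascent L x
stair-∷ʳ-maximal L l x with L ≤? l
... | yes L≤l = begin
  asc (stair L ∷ʳ l) + ascent l x   ≡⟨ cong (_+ ascent l x) (asc-stair-∷ʳ-≥ L L≤l) ⟩
  L + ascent l x                    ≤⟨ +-monoʳ-≤ L (ascent-antimonoˡ-≤ {y = x} L≤l) ⟩
  L + ascent L x                    ∎
  where open ≤-Reasoning
... | no  L≰l = begin
  asc (stair L ∷ʳ l) + ascent l x   ≤⟨ +-monoʳ-≤ (asc (stair L ∷ʳ l)) (ascent≤1 l x) ⟩
  asc (stair L ∷ʳ l) + 1            ≡⟨ +-comm (asc (stair L ∷ʳ l)) 1 ⟩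
  suc (asc (stair L ∷ʳ l))          ≡⟨ asc-stair-∷ʳ-< (≰⇒> L≰l) ⟩
  L                                 ≤⟨ m≤m+n L (ascent L x) ⟩
  L + ascent L x                    ∎
  where open ≤-Reasoning

InA-stair-∷ʳ : ∀ L {x} → x ≤ L → InA (suc L) (stair L ∷ʳ x)
InA-stair-∷ʳ zero    z≤n   = InA-[0]
InA-stair-∷ʳ (suc L) {x} x≤1+L =
  InA-∷ʳ (InA-stair-∷ʳ L ≤-refl)
         (subst (λ a → x ≤ a + 1) (sym (asc-stair-∷ʳ-≥ L ≤-refl))
                (subst (x ≤_) (+-comm 1 L) x≤1+L))

last≤asc : ∀ {n p x} → Reverse p → InA n (p ∷ʳ x) → x ≤ asc (p ∷ʳ x)
last≤asc [] ia = ≤-reflexive (InA-head ia)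
last≤asc {x = x} (p ∶ rp ∶ʳ l) ia rewrite asc-∷ʳ-∷ʳ p l x with l <? x
... | yes l<x rewrite ascent-< l<x = InA.bound ia (p ∷ʳ l) x [] refl (++-∷≢[] p)
... | no  l≮x rewrite ascent-≥ (≮⇒≥ l≮x) | +-identityʳ (asc (p ∷ʳ l)) =
  ≤-trans (≮⇒≥ l≮x) (last≤asc rp (InA-prefix (p ∷ʳ l) (x ∷ []) (++-∷≢[] p) ia))

asc-∷ʳ≤asc-stair-∷ʳ : ∀ {n p x} → Reverse p → InA n (p ∷ʳ x) →
                      asc (p ∷ʳ x) ≤ asc (stair (length p) ∷ʳ x)
asc-∷ʳ≤asc-stair-∷ʳ [] _ = z≤n
asc-∷ʳ≤asc-stair-∷ʳ {x = x} (p ∶ rp ∶ʳ l) ia rewrite length-∷ʳ p l = begin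
  asc (p ∷ʳ l ∷ʳ x)                           ≡⟨ asc-∷ʳ-∷ʳ p l x ⟩
  asc (p ∷ʳ l) + ascent l x                   ≤⟨ +-monoˡ-≤ (ascent l x) init-bound ⟩
  asc (stair (length p) ∷ʳ l) + ascent l x    ≤⟨ stair-∷ʳ-maximal (length p) l x ⟩
  length p + ascent (length p) x              ≡⟨ asc-stair-suc-∷ʳ (length p) x ⟨
  asc (stair (suc (length p)) ∷ʳ x)           ∎
  where
  open ≤-Reasoning
  init-bound : asc (p ∷ʳ l) ≤ asc (stair (length p) ∷ʳ l)
  init-bound = asc-∷ʳ≤asc-stair-∷ʳ rp (InA-prefix (p ∷ʳ l) (x ∷ []) (++-∷≢[] p) ia)

last≤length : ∀ {n} p x → InA n (p ∷ʳ x) → x ≤ length p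
last≤length p x ia = begin
  x                                 ≤⟨ last≤asc (reverseView p) ia ⟩
  asc (p ∷ʳ x)                      ≤⟨ asc-∷ʳ≤asc-stair-∷ʳ (reverseView p) ia ⟩
  asc (stair (length p) ∷ʳ x)       ≤⟨ asc-stair-∷ʳ≤ (length p) x ⟩
  length p                          ∎
  where open ≤-Reasoning

module Suffix {n K b₁ : ℕ} {bs : List ℕ} {m : ℕ} {pre : List ℕ}
  (total-length : suc K + length (b₁ ∷ bs) ≡ n)
  (pre-length : length pre ≡ suc K)
  (pre-InA : InA n (pre ++ b₁ ∷ bs))
  (pre-asc : asc (pre ∷ʳ b₁) ≡ m)
  (μ-minimal : ∀ q → length q ≡ suc K → InA n (q ++ b₁ ∷ bs) → m ≤ asc (q ∷ʳ b₁))
  where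

  private
    pre∷ʳb₁-InA : InA (length (pre ∷ʳ b₁)) (pre ∷ʳ b₁)
    pre∷ʳb₁-InA = InA-prefix (pre ∷ʳ b₁) bs (++-∷≢[] pre)
                             (subst (InA n) (sym (∷ʳ-++ pre b₁ bs)) pre-InA)

  b₁≤μ : b₁ ≤ m
  b₁≤μ = subst (b₁ ≤_) pre-asc (last≤asc (reverseView pre) pre∷ʳb₁-InA)

  μ≤ : m ≤ K + ascent K b₁
  μ≤ = begin
    m                                  ≡⟨ pre-asc ⟨
    asc (pre ∷ʳ b₁)                    ≤⟨ asc-∷ʳ≤asc-stair-∷ʳ (reverseView pre) pre∷ʳb₁-InA ⟩
    asc (stair (length pre) ∷ʳ b₁)     ≡⟨ cong (λ L → asc (stair L ∷ʳ b₁)) pre-length ⟩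
    asc (stair (suc K) ∷ʳ b₁)          ≡⟨ asc-stair-suc-∷ʳ K b₁ ⟩
    K + ascent K b₁                    ∎
    where open ≤-Reasoning

  FitsStair : ℕ → Set
  FitsStair x = x ≤ K × b₁ ≤ asc (stair K ∷ʳ x) + 1 × m ≤ asc (stair K ∷ʳ x) + ascent x b₁

  α⇒FitsStair : ∀ {x} → α n (b₁ ∷ bs) x → FitsStair x
  α⇒FitsStair {x} (p , ia) = subst (x ≤_) p-length (last≤length p x init-InA) , b₁≤ , m≤
    where
    open ≤-Reasoning
    ia′ : InA n (p ∷ʳ x ++ b₁ ∷ bs)
    ia′ = subst (InA n) (sym (∷ʳ-++ p x (b₁ ∷ bs))) ia
    init-length : length (p ∷ʳ x) ≡ suc K
    init-length = +-cancelʳ-≡ (length (b₁ ∷ bs)) (length (p ∷ʳ x)) (suc K)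
      (trans (sym (length-++ (p ∷ʳ x))) (trans (InA.len ia′) (sym total-length)))
    p-length : length p ≡ K
    p-length = suc-injective (trans (sym (length-∷ʳ p x)) init-length)
    init-InA : InA (length (p ∷ʳ x)) (p ∷ʳ x)
    init-InA = InA-prefix (p ∷ʳ x) (b₁ ∷ bs) (++-∷≢[] p) ia′
    init≤stair : asc (p ∷ʳ x) ≤ asc (stair K ∷ʳ x)
    init≤stair = subst (λ L → asc (p ∷ʳ x) ≤ asc (stair L ∷ʳ x)) p-length
                       (asc-∷ʳ≤asc-stair-∷ʳ (reverseView p) init-InA)
    b₁≤ : b₁ ≤ asc (stair K ∷ʳ x) + 1
    b₁≤ = ≤-trans (InA.bound ia′ (p ∷ʳ x) b₁ bs refl (++-∷≢[] p)) (+-monoˡ-≤ 1 init≤stair)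
    m≤ : m ≤ asc (stair K ∷ʳ x) + ascent x b₁
    m≤ = begin
      m                                  ≤⟨ μ-minimal (p ∷ʳ x) init-length ia′ ⟩
      asc (p ∷ʳ x ∷ʳ b₁)                 ≡⟨ asc-∷ʳ-∷ʳ p x b₁ ⟩
      asc (p ∷ʳ x) + ascent x b₁         ≤⟨ +-monoˡ-≤ (ascent x b₁) init≤stair ⟩
      asc (stair K ∷ʳ x) + ascent x b₁   ∎

  FitsStair⇒α : ∀ {x} → FitsStair x → α n (b₁ ∷ bs) x
  FitsStair⇒α {x} (x≤K , b₁≤ , m≤) =
    stair K , subst (InA n) (∷ʳ-++ (stair K) x (b₁ ∷ bs))
                    (InA-replace-prefix pre-InA stair-InA b₁≤ pre≤stair)
    where
    stair-InA : InA (length pre) (stair K ∷ʳ x)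
    stair-InA = subst (λ L → InA L (stair K ∷ʳ x)) (sym pre-length) (InA-stair-∷ʳ K x≤K)
    pre≤stair : asc (pre ∷ʳ b₁) ≤ asc (stair K ∷ʳ x ∷ʳ b₁)
    pre≤stair = subst₂ _≤_ (sym pre-asc) (sym (asc-∷ʳ-∷ʳ (stair K) x b₁)) m≤

  α⇒≤ : ∀ {x} → α n (b₁ ∷ bs) x → x ≤ K
  α⇒≤ αx = proj₁ (α⇒FitsStair αx)

  α-top : α n (b₁ ∷ bs) K
  α-top = FitsStair⇒α
    (≤-refl , subst (λ a → b₁ ≤ a + 1 × m ≤ a + ascent K b₁) (sym top) (b₁≤K+1 , μ≤))
    where
    top : asc (stair K ∷ʳ K) ≡ K
    top = asc-stair-∷ʳ-≥ K ≤-refl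
    b₁≤K+1 : b₁ ≤ K + 1
    b₁≤K+1 = ≤-trans b₁≤μ (≤-trans μ≤ (+-monoʳ-≤ K (ascent≤1 K b₁)))

  α-below : ∀ {x} → x < K → α n (b₁ ∷ bs) x ⇔ (b₁ ≤ K × m < K + ascent x b₁)
  α-below {x} x<K =
    subst (λ k → α n (b₁ ∷ bs) x ⇔ (b₁ ≤ k × m < k + ascent x b₁)) (asc-stair-∷ʳ-< x<K)
          (mk⇔ to from)
    where
    a : ℕ
    a = asc (stair K ∷ʳ x)
    to : α n (b₁ ∷ bs) x → b₁ ≤ suc a × m < suc a + ascent x b₁
    to αx = let (_ , b₁≤ , m≤) = α⇒FitsStair αx in subst (b₁ ≤_) (+-comm a 1) b₁≤ , s≤s m≤
    from : b₁ ≤ suc a × m < suc a + ascent x b₁ → α n (b₁ ∷ bs) x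
    from (b₁≤ , m<) = FitsStair⇒α (<⇒≤ x<K , subst (b₁ ≤_) (+-comm 1 a) b₁≤ , ≤-pred m<)

  α⇔≡K : m ≡ suc K ⊎ (m ≡ K × b₁ ≡ 0) → ∀ x → α n (b₁ ∷ bs) x ⇔ x ≡ K
  α⇔≡K μ-large x = mk⇔ to (λ x≡K → subst (α n (b₁ ∷ bs)) (sym x≡K) α-top)
    where
    excluded : m ≡ suc K ⊎ (m ≡ K × b₁ ≡ 0) → m < K + ascent x b₁ → ⊥
    excluded (inj₁ m≡1+K) m< =
      <⇒≱ m< (subst (K + ascent x b₁ ≤_) (trans (+-comm K 1) (sym m≡1+K))
                    (+-monoʳ-≤ K (ascent≤1 x b₁)))
    excluded (inj₂ (m≡K , b₁≡0)) m< =
      <-irrefl m≡K (subst (m <_) K+0≡K m<)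
      where
      K+0≡K : K + ascent x b₁ ≡ K
      K+0≡K = trans (cong (K +_) (ascent-≥ (subst (_≤ x) (sym b₁≡0) z≤n))) (+-identityʳ K)
    to : α n (b₁ ∷ bs) x → x ≡ K
    to αx with m≤n⇒m<n∨m≡n (α⇒≤ αx)
    ... | inj₁ x<K = ⊥-elim (excluded μ-large (proj₂ (Equivalence.to (α-below x<K) αx)))
    ... | inj₂ x≡K = x≡K

  α⇔<b₁⊎≡K : m ≡ K → b₁ ≤ K → ∀ x → α n (b₁ ∷ bs) x ⇔ (x < b₁ ⊎ x ≡ K)
  α⇔<b₁⊎≡K m≡K b₁≤K x = mk⇔ to from
    where
    to : α n (b₁ ∷ bs) x → x < b₁ ⊎ x ≡ K
    to αx with m≤n⇒m<n∨m≡n (α⇒≤ αx) | x <? b₁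
    ... | inj₂ x≡K | _        = inj₂ x≡K
    ... | inj₁ _   | yes x<b₁ = inj₁ x<b₁
    ... | inj₁ x<K | no  x≮b₁ =
      ⊥-elim (<-irrefl m≡K (subst (m <_) K+0≡K (proj₂ (Equivalence.to (α-below x<K) αx))))
      where
      K+0≡K : K + ascent x b₁ ≡ K
      K+0≡K = trans (cong (K +_) (ascent-≥ (≮⇒≥ x≮b₁))) (+-identityʳ K)
    from : x < b₁ ⊎ x ≡ K → α n (b₁ ∷ bs) x
    from (inj₂ x≡K)  = subst (α n (b₁ ∷ bs)) (sym x≡K) α-top
    from (inj₁ x<b₁) = Equivalence.from (α-below (<-≤-trans x<b₁ b₁≤K)) (b₁≤K , m<K+1)
      where
      m<K+1 : m < K + ascent x b₁
      m<K+1 = subst₂ _<_ (sym m≡K) (trans (+-comm 1 K) (cong (K +_) (sym (ascent-< x<b₁)))) ≤-refl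

  α⇔<1+K : m < K → ∀ x → α n (b₁ ∷ bs) x ⇔ x < suc K
  α⇔<1+K m<K x = mk⇔ (λ αx → s≤s (α⇒≤ αx)) from
    where
    from : x < suc K → α n (b₁ ∷ bs) x
    from x<1+K with m≤n⇒m<n∨m≡n (≤-pred x<1+K)
    ... | inj₂ x≡K = subst (α n (b₁ ∷ bs)) (sym x≡K) α-top
    ... | inj₁ x<K = Equivalence.from (α-below x<K)
                       (≤-trans b₁≤μ (<⇒≤ m<K) , <-≤-trans m<K (m≤m+n K (ascent x b₁)))

α-[]⇔ : ∀ K x → α (suc K) [] x ⇔ x < suc K
α-[]⇔ K x = mk⇔ (λ (p , ia) → s≤s (subst (x ≤_) (p-length p ia) (last≤length p x ia)))
                (λ x<1+K → stair K , InA-stair-∷ʳ K (≤-pred x<1+K))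
  where
  p-length : ∀ p → InA (suc K) (p ∷ʳ x) → length p ≡ K
  p-length p ia = suc-injective (trans (sym (length-∷ʳ p x)) (InA.len ia))

proposition7 : (∀ (n k b₁ : ℕ) (bs : List ℕ) (m : ℕ) →
    1 ≤ k → k < n → k + length (b₁ ∷ bs) ≡ n →
    Admissible n (b₁ ∷ bs) → IsMu n k b₁ bs m →
    ((m ≡ k ⊎ (m ≡ k ∸ 1 × b₁ ≡ 0)) →
    ∀ x → α n (b₁ ∷ bs) x ⇔ x ≡ k ∸ 1)
    × ((m ≡ k ∸ 1 × 0 < b₁ × b₁ < k) →
    ∀ x → α n (b₁ ∷ bs) x ⇔ (x < b₁ ⊎ x ≡ k ∸ 1))
    × (m < k ∸ 1 →
    ∀ x → α n (b₁ ∷ bs) x ⇔ x < k))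
    × (∀ (n : ℕ) → 1 ≤ n → ∀ x → α n [] x ⇔ x < n)
proj₁ proposition7 _ zero _ _ _ ()
proj₁ proposition7 n (suc K) b₁ bs m _ _ total-length _
                   ((pre , pre-length , pre-InA , pre-asc) , μ-minimal) =
  α⇔≡K , (λ (m≡K , _ , b₁<1+K) → α⇔<b₁⊎≡K m≡K (≤-pred b₁<1+K)) , α⇔<1+K
  where open Suffix total-length pre-length pre-InA pre-asc μ-minimal
proj₂ proposition7 zero    ()
proj₂ proposition7 (suc K) _ = α-[]⇔ K
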